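{- For every $v\equiv 0\pmod 4$ with $v\geq 12$ there exists a connected symmetric configuration $v_3$ with strong chromatic number exactly $5$.
   Context: A symmetric configuration $v_3$ is a finite incidence structure consisting of a set $V$ of $v$ points and a collection of $v$ blocks, each block a $3$-element subset of $V$, such that each point lies in exactly $3$ blocks and any two distinct points lie together in at most one block. It is connected if it is not the union of two configurations on disjoint point sets. A strong colouring assigns colours to points so that the three points of every block receive distinct colours; the strong chromatic number is the least number of colours in a strong colouring. -}

module Defs where

open import Data.Nat using (ℕ; _<_)
open import Data.Fin using (Fin)
open import Data.Bool using (Bool)
open import Data.Product using (Σ; ∃; _×_)
open import Relation.Nullary using (¬_)
open import Relation.Binary.PropositionalEquality using (_≡_; _≢_)

_∈ᵇ_ : ∀ {v} → Fin v → (Fin 3 → Fin v) → Set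
p ∈ᵇ B = ∃ λ i → B i ≡ p

-- A symmetric configuration v_3: points are Fin v, blocks are indexed by Fin v
-- (so there are exactly v blocks), each block consists of 3 distinct points,
-- each point lies in exactly 3 blocks, any two distinct points lie together
-- in at most one block.
record Configuration (v : ℕ) : Set where
  field
    block        : Fin v → Fin 3 → Fin v
    block-inj    : ∀ b i j → block b i ≡ block b j → i ≡ j
    -- each point lies in exactly 3 blocks: there is an injective enumeration
    -- of three blocks through p which lists every block through p
    through      : Fin v → Fin 3 → Fin v
    through-inj  : ∀ p i j → through p i ≡ through p j → i ≡ j
    through-inc  : ∀ p i → p ∈ᵇ block (through p i)
    through-all  : ∀ p b → p ∈ᵇ block b → ∃ λ i → through p i ≡ b
    linear       : ∀ p q → p ≢ q → ∀ b b' →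
                   p ∈ᵇ block b → q ∈ᵇ block b →
                   p ∈ᵇ block b' → q ∈ᵇ block b' → b ≡ b'

open Configuration public

-- Connected: the configuration does not split as the union of two
-- configurations on disjoint point sets, i.e. every 2-partition of the points
-- such that each block lies entirely within one part is trivial.
Connected : ∀ {v} → Configuration v → Set
Connected {v} C =
  (S : Fin v → Bool) →
  (∀ b i j → S (block C b i) ≡ S (block C b j)) →
  ∀ p q → S p ≡ S q

StrongColouring : ∀ {v} → Configuration v → ℕ → Set
StrongColouring {v} C k =
  Σ (Fin v → Fin k) λ c → ∀ b i j → c (block C b i) ≡ c (block C b j) → i ≡ j

StrongChromaticNumber : ∀ {v} → Configuration v → ℕ → Set
StrongChromaticNumber C n =
  StrongColouring C n × (∀ k → k < n → ¬ StrongColouring C k)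

-- Five pairwise collinear points need five distinct colours, so a strong 5-colouring of a configuration
-- containing five such points shows its strong chromatic number is 5.  Starting from a 12-point example,
-- an expansion step deletes two disjoint blocks P = {P₀,P₁,P₂} and Q = {Q₀,Q₁,Q₂}, adds four points
-- x₀,…,x₃ and six blocks, each consisting of one pair {xₐ,x_b} and one point of P ∪ Q.  This adds four
-- points and four blocks, keeps the configuration linear and connected, and keeps five pairwise collinear
-- points chosen off P and Q.  If P and Q were coloured 0,1,2 and 0,1,3, colouring xₐ with a gives a
-- strong 5-colouring in which the new blocks {x₀,P₁,x₂} and {Q₀,x₁,x₃} are again coloured 0,1,2 and
-- 0,1,3 and disjoint, so the step can be repeated.
module Submission where

open import Data.Bool using (Bool)
open import Data.Fin using (Fin; zero; suc; #_; _↑ˡ_; _↑ʳ_; _<_; _<?_; _≟_; splitAt; join; inject₁)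
open import Data.Fin.Induction using (<-wellFounded; Acc; acc)
open import Data.Fin.Patterns using (0F; 1F)
open import Data.Fin.Properties
  using (all?; any?; injective⇒≤; suc-injective; ↑ˡ-injective; ↑ʳ-injective; join-splitAt)
open import Data.Nat using (ℕ; zero; suc; _+_; _*_; _≤_; _≤?_)
open import Data.Nat.Divisibility using (_∣_; divides)
open import Data.Nat.Properties using (<⇒≱)
open import Data.Product using (Σ; ∃; ∃₂; _×_; _,_)
open import Data.Sum using (inj₁; inj₂; [_,_])
open import Data.Vec.Functional using (_∷_; []; _++_)
open import Data.Vec.Functional.Properties using (lookup-++ˡ)
open import Function using (_∘_)
open import Function.Definitions using (Injective)
open import Relation.Nullary using (Dec; yes; no; contradiction)
open import Relation.Nullary.Decidable using (from-yes; from-no; map′; _→-dec_; _×-dec_; ¬?)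
open import Relation.Binary.PropositionalEquality
  using (_≡_; _≢_; _≗_; refl; sym; trans; cong; cong-app; subst; subst₂; module ≡-Reasoning)

open import Defs

↑-cases : ∀ {m n} {P : Fin (m + n) → Set} →
          (∀ i → P (i ↑ˡ n)) → (∀ j → P (m ↑ʳ j)) → ∀ k → P k
↑-cases {m} {n} {P} left right k = subst P (join-splitAt m n k) (cases (splitAt m k))
  where
  cases : ∀ s → P (join m n s)
  cases (inj₁ i) = left i
  cases (inj₂ j) = right j

↑ˡ≢↑ʳ : ∀ {m n} (i : Fin m) (j : Fin n) → i ↑ˡ n ≢ m ↑ʳ j
↑ˡ≢↑ʳ zero    j ()
↑ˡ≢↑ʳ (suc i) j eq = ↑ˡ≢↑ʳ i j (suc-injective eq)

++-injective : ∀ {m n} {A : Set} {f : Fin m → A} {g : Fin n → A} →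
               Injective _≡_ _≡_ f → Injective _≡_ _≡_ g → (∀ i j → f i ≢ g j) →
               Injective _≡_ _≡_ (f ++ g)
++-injective {m} {n} {f = f} {g} f-inj g-inj f≢g {x} {y} eq = begin
  x                          ≡⟨ join-splitAt m n x ⟨
  join m n (splitAt m x)     ≡⟨ cong (join m n) (case-injective (splitAt m x) (splitAt m y) eq) ⟩
  join m n (splitAt m y)     ≡⟨ join-splitAt m n y ⟩
  y                          ∎
  where
  open ≡-Reasoning
  case-injective : ∀ s t → [ f , g ] s ≡ [ f , g ] t → s ≡ t
  case-injective (inj₁ i) (inj₁ j) e = cong inj₁ (f-inj e)
  case-injective (inj₁ i) (inj₂ j) e = contradiction e (f≢g i j)
  case-injective (inj₂ i) (inj₁ j) e = contradiction (sym e) (f≢g j i)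
  case-injective (inj₂ i) (inj₂ j) e = cong inj₂ (g-inj e)

-- A left inverse of f on its image; zero elsewhere.
preimage : ∀ {m n} → (Fin (1 + m) → Fin n) → Fin n → Fin (1 + m)
preimage f y with any? (λ t → f t ≟ y)
... | yes (t , _) = t
... | no _        = zero

preimage-correct : ∀ {m n} {f : Fin (1 + m) → Fin n} → Injective _≡_ _≡_ f →
                   ∀ {t y} → f t ≡ y → preimage f y ≡ t
preimage-correct {f = f} f-inj {t} {y} ft≡y with any? (λ s → f s ≟ y)
... | yes (s , fs≡y) = f-inj (trans fs≡y (sym ft≡y))
... | no  ∄s         = contradiction (t , ft≡y) ∄s

injective? : ∀ {m n} (f : Fin m → Fin n) → Dec (Injective _≡_ _≡_ f)
injective? f = map′ (λ inj → inj _ _) (λ inj _ _ → inj)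
                    (all? λ i → all? λ j → (f i ≟ f j) →-dec (i ≟ j))

Collinear : ∀ {v} → Configuration v → Fin v → Fin v → Set
Collinear C p q = ∃ λ b → p ∈ᵇ block C b × q ∈ᵇ block C b

clique⇒≤colours : ∀ {v k m} (C : Configuration v) (f : Fin k → Fin v) → Injective _≡_ _≡_ f →
                  (∀ i j → i ≢ j → Collinear C (f i) (f j)) → StrongColouring C m → k ≤ m
clique⇒≤colours C f f-inj collinear (c , strong) = injective⇒≤ c∘f-injective
  where
  c∘f-injective : Injective _≡_ _≡_ (c ∘ f)
  c∘f-injective {i} {j} same with i ≟ j
  ... | yes i≡j = i≡j
  ... | no  i≢j with collinear i j i≢j
  ...   | b , (k , bk≡fi) , (l , bl≡fj) =
          f-inj (trans (sym bk≡fi) (trans (cong (block C b) k≡l) bl≡fj))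
    where
    k≡l : k ≡ l
    k≡l = strong b k l (subst₂ (λ x y → c x ≡ c y) (sym bk≡fi) (sym bl≡fj) same)

clique⇒strongChromaticNumber :
  ∀ {v k} (C : Configuration v) → StrongColouring C k →
  (f : Fin k → Fin v) → Injective _≡_ _≡_ f → (∀ i j → i ≢ j → Collinear C (f i) (f j)) →
  StrongChromaticNumber C k
clique⇒strongChromaticNumber C colouring f f-inj collinear =
  colouring , λ m m<k colouring′ → <⇒≱ m<k (clique⇒≤colours C f f-inj collinear colouring′)

Linear : ∀ {m v} → (Fin m → Fin 3 → Fin v) → Set
Linear B = ∀ p q → p ≢ q → ∀ b b' → p ∈ᵇ B b → q ∈ᵇ B b → p ∈ᵇ B b' → q ∈ᵇ B b' → b ≡ b'

MeetsOnce : ∀ {m v} → (Fin m → Fin 3 → Fin v) → Fin m → Fin m → Set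
MeetsOnce B b b' = b ≢ b' → ∀ i j i' j' → B b i ≡ B b' i' → B b j ≡ B b' j' → i ≡ j

MeetOnce : ∀ {m v} → (Fin m → Fin 3 → Fin v) → Set
MeetOnce B = ∀ b b' → MeetsOnce B b b'

meetOnce? : ∀ {m v} (B : Fin m → Fin 3 → Fin v) → Dec (MeetOnce B)
meetOnce? B = all? λ b → all? λ b' → ¬? (b ≟ b') →-dec
  all? λ i → all? λ j → all? λ i' → all? λ j' →
  (B b i ≟ B b' i') →-dec ((B b j ≟ B b' j') →-dec (i ≟ j))

meetOnce⇒linear : ∀ {m v} {B : Fin m → Fin 3 → Fin v} → MeetOnce B → Linear B
meetOnce⇒linear {B = B} meet p q p≢q b b' (i , bi≡p) (j , bj≡q) (i' , b'i'≡p) (j' , b'j'≡q)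
  with b ≟ b'
... | yes b≡b' = b≡b'
... | no  b≢b' = contradiction (trans (sym bi≡p) (trans (cong (B b) i≡j) bj≡q)) p≢q
  where
  i≡j : i ≡ j
  i≡j = meet b b' b≢b' i j i' j' (trans bi≡p (sym b'i'≡p)) (trans bj≡q (sym b'j'≡q))

linear⇒meetOnce : ∀ {v} (C : Configuration v) → MeetOnce (block C)
linear⇒meetOnce C b b' b≢b' i j i' j' bi≡b'i' bj≡b'j' with i ≟ j
... | yes i≡j = i≡j
... | no  i≢j = contradiction
  (linear C (block C b i) (block C b j) (i≢j ∘ block-inj C b i j) b b'
          (i , refl) (j , refl) (i' , sym bi≡b'i') (j' , sym bj≡b'j'))
  b≢b'

ConstantOnBlocks : ∀ {m v} → (Fin m → Fin 3 → Fin v) → (Fin v → Bool) → Set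
ConstantOnBlocks B S = ∀ b i j → S (B b i) ≡ S (B b j)

Descending : ∀ {m v} → (Fin m → Fin 3 → Fin (1 + v)) → Set
Descending B = ∀ p → p ≢ zero → ∃₂ λ b i → B b i ≡ p × ∃ λ j → B b j < p

descending? : ∀ {m v} (B : Fin m → Fin 3 → Fin (1 + v)) → Dec (Descending B)
descending? B = all? λ p → ¬? (p ≟ zero) →-dec
  any? λ b → any? λ i → (B b i ≟ p) ×-dec any? λ j → B b j <? p

descending⇒constant : ∀ {m v} {B : Fin m → Fin 3 → Fin (1 + v)} {S : Fin (1 + v) → Bool} →
                      Descending B → ConstantOnBlocks B S → ∀ p → S p ≡ S zero
descending⇒constant {B = B} {S} descending constant p = go (<-wellFounded p)
  where
  go : ∀ {p} → Acc _<_ p → S p ≡ S zero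
  go {p} (acc below) with p ≟ zero
  ... | yes p≡0 = cong S p≡0
  ... | no  p≢0 with descending p p≢0
  ...   | b , i , bi≡p , j , bj<p =
          trans (cong S (sym bi≡p)) (trans (constant b i j) (go (below bj<p)))

descending⇒connected : ∀ {v} (C : Configuration (1 + v)) → Descending (block C) → Connected C
descending⇒connected C descending S constant p q =
  trans (descending⇒constant descending constant p) (sym (descending⇒constant descending constant q))

palette₀ palette₁ : Fin 3 → Fin 5
palette₀ = # 0 ∷ # 1 ∷ # 2 ∷ []
palette₁ = # 0 ∷ # 1 ∷ # 3 ∷ []

-- Blocks 0F and 1F are the two blocks the expansion step removes; the clique is
-- witnessed by the other blocks, which the step keeps.
record Expandable (w : ℕ) : Set where
  field
    config           : Configuration (2 + w)
    connected        : Connected config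
    colour           : Fin (2 + w) → Fin 5
    strong           : ∀ b i j → colour (block config b i) ≡ colour (block config b j) → i ≡ j
    colours₀         : colour ∘ block config 0F ≗ palette₀
    colours₁         : colour ∘ block config 1F ≗ palette₁
    disjoint         : ∀ i j → block config 0F i ≢ block config 1F j
    clique           : Fin 5 → Fin (2 + w)
    clique-injective : Injective _≡_ _≡_ clique
    clique-collinear : ∀ i j → i ≢ j →
                       ∃ λ c → clique i ∈ᵇ block config (2 ↑ʳ c) × clique j ∈ᵇ block config (2 ↑ʳ c)

expandable⇒strongChromaticNumber : ∀ {w} (E : Expandable w) →
  let open Expandable E in Connected config × StrongChromaticNumber config 5
expandable⇒strongChromaticNumber E =
  connected , clique⇒strongChromaticNumber config (colour , strong) clique clique-injective collinear
  where
  open Expandable E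
  collinear : ∀ i j → i ≢ j → Collinear config (clique i) (clique j)
  collinear i j i≢j with clique-collinear i j i≢j
  ... | c , on-i , on-j = 2 ↑ʳ c , on-i , on-j

module Base where

  blocks : Fin 12 → Fin 3 → Fin 12
  blocks =
    (# 0 ∷ # 7 ∷ # 9  ∷ []) ∷ (# 5 ∷ # 8 ∷ # 10 ∷ []) ∷ (# 0 ∷ # 1 ∷ # 2  ∷ []) ∷
    (# 0 ∷ # 3 ∷ # 4  ∷ []) ∷ (# 1 ∷ # 3 ∷ # 5  ∷ []) ∷ (# 1 ∷ # 4 ∷ # 6  ∷ []) ∷
    (# 2 ∷ # 3 ∷ # 7  ∷ []) ∷ (# 2 ∷ # 4 ∷ # 8  ∷ []) ∷ (# 5 ∷ # 9 ∷ # 11 ∷ []) ∷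
    (# 6 ∷ # 8 ∷ # 11 ∷ []) ∷ (# 6 ∷ # 9 ∷ # 10 ∷ []) ∷ (# 7 ∷ # 10 ∷ # 11 ∷ []) ∷ []

  blocksThrough : Fin 12 → Fin 3 → Fin 12
  blocksThrough =
    (# 0 ∷ # 2 ∷ # 3  ∷ []) ∷ (# 2 ∷ # 4 ∷ # 5  ∷ []) ∷ (# 2 ∷ # 6 ∷ # 7  ∷ []) ∷
    (# 3 ∷ # 4 ∷ # 6  ∷ []) ∷ (# 3 ∷ # 5 ∷ # 7  ∷ []) ∷ (# 1 ∷ # 4 ∷ # 8  ∷ []) ∷
    (# 5 ∷ # 9 ∷ # 10 ∷ []) ∷ (# 0 ∷ # 6 ∷ # 11 ∷ []) ∷ (# 1 ∷ # 7 ∷ # 9  ∷ []) ∷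
    (# 0 ∷ # 8 ∷ # 10 ∷ []) ∷ (# 1 ∷ # 10 ∷ # 11 ∷ []) ∷ (# 8 ∷ # 9 ∷ # 11 ∷ []) ∷ []

  colour : Fin 12 → Fin 5
  colour = # 0 ∷ # 1 ∷ # 2 ∷ # 3 ∷ # 4 ∷ # 0 ∷ # 0 ∷ # 1 ∷ # 1 ∷ # 2 ∷ # 3 ∷ # 4 ∷ []

  configuration : Configuration 12
  configuration = record
    { block       = blocks
    ; block-inj   = λ b _ _ → from-yes (all? λ b → injective? (blocks b)) b
    ; through     = blocksThrough
    ; through-inj = λ p _ _ → from-yes (all? λ p → injective? (blocksThrough p)) p
    ; through-inc = from-yes (all? λ p → all? λ i → any? λ k → blocks (blocksThrough p i) k ≟ p)
    ; through-all = from-yes (all? λ p → all? λ b →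
                      (any? λ k → blocks b k ≟ p) →-dec (any? λ i → blocksThrough p i ≟ b))
    ; linear      = meetOnce⇒linear (from-yes (meetOnce? blocks))
    }

  expandable : Expandable 10
  expandable = record
    { config           = configuration
    ; connected        = descending⇒connected configuration (from-yes (descending? blocks))
    ; colour           = colour
    ; strong           = λ b _ _ → from-yes (all? λ b → injective? (colour ∘ blocks b)) b
    ; colours₀         = from-yes (all? λ k → colour (blocks 0F k) ≟ palette₀ k)
    ; colours₁         = from-yes (all? λ k → colour (blocks 1F k) ≟ palette₁ k)
    ; disjoint         = from-yes (all? λ i → all? λ j → ¬? (blocks 0F i ≟ blocks 1F j))
    ; clique           = _↑ˡ 7
    ; clique-injective = ↑ˡ-injective 7 _ _
    ; clique-collinear = from-yes (all? λ (i : Fin 5) → all? λ j → ¬? (i ≟ j) →-dec any? λ c →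
                           (any? λ k → blocks (2 ↑ʳ c) k ≟ i ↑ˡ 7) ×-dec (any? λ k → blocks (2 ↑ʳ c) k ≟ j ↑ˡ 7))
    }

-- Gadget points 0–3 are the four new points (hubs); gadget point 4 ↑ʳ t stands for the t-th point
-- of the two removed blocks listed one after the other.
gadget : Fin 6 → Fin 3 → Fin 10
gadget =
  (# 0 ∷ # 5 ∷ # 2 ∷ []) ∷ (# 7 ∷ # 1 ∷ # 3 ∷ []) ∷ (# 4 ∷ # 1 ∷ # 2 ∷ []) ∷
  (# 6 ∷ # 0 ∷ # 3 ∷ []) ∷ (# 8 ∷ # 2 ∷ # 3 ∷ []) ∷ (# 9 ∷ # 0 ∷ # 1 ∷ []) ∷ []

hubBlocks : Fin 4 → Fin 3 → Fin 6
hubBlocks = (# 0 ∷ # 3 ∷ # 5 ∷ []) ∷ (# 1 ∷ # 2 ∷ # 5 ∷ []) ∷ (# 0 ∷ # 2 ∷ # 4 ∷ []) ∷ (# 1 ∷ # 3 ∷ # 4 ∷ []) ∷ []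

home : Fin 6 → Fin 6
home = # 2 ∷ # 0 ∷ # 3 ∷ # 1 ∷ # 4 ∷ # 5 ∷ []

gadgetColour : Fin 10 → Fin 5
gadgetColour = inject₁ ++ (palette₀ ++ palette₁)

gadget-injective : ∀ n → Injective _≡_ _≡_ (gadget n)
gadget-injective = from-yes (all? λ n → injective? (gadget n))

gadget-meetOnce : MeetOnce gadget
gadget-meetOnce = from-yes (meetOnce? gadget)

gadget-oneAttachment : ∀ n i j t t′ → gadget n i ≡ 4 ↑ʳ t → gadget n j ≡ 4 ↑ʳ t′ → i ≡ j
gadget-oneAttachment = from-yes (all? λ n → all? λ i → all? λ j → all? λ (t : Fin 6) → all? λ (t′ : Fin 6) →
  (gadget n i ≟ 4 ↑ʳ t) →-dec ((gadget n j ≟ 4 ↑ʳ t′) →-dec (i ≟ j)))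

attachment∈home : ∀ t → (4 ↑ʳ t) ∈ᵇ gadget (home t)
attachment∈home = from-yes (all? λ t → any? λ k → gadget (home t) k ≟ 4 ↑ʳ t)

home-unique : ∀ n i t → gadget n i ≡ 4 ↑ʳ t → home t ≡ n
home-unique = from-yes (all? λ n → all? λ i → all? λ t → (gadget n i ≟ 4 ↑ʳ t) →-dec (home t ≟ n))

hubBlocks-injective : ∀ a → Injective _≡_ _≡_ (hubBlocks a)
hubBlocks-injective = from-yes (all? λ a → injective? (hubBlocks a))

hub∈hubBlocks : ∀ a i → (a ↑ˡ 6) ∈ᵇ gadget (hubBlocks a i)
hub∈hubBlocks = from-yes (all? λ a → all? λ i → any? λ k → gadget (hubBlocks a i) k ≟ a ↑ˡ 6)

hubBlocks-complete : ∀ a n → (a ↑ˡ 6) ∈ᵇ gadget n → ∃ λ i → hubBlocks a i ≡ n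
hubBlocks-complete = from-yes (all? λ a → all? λ n →
  (any? λ k → gadget n k ≟ a ↑ˡ 6) →-dec (any? λ i → hubBlocks a i ≟ n))

gadget-strong : ∀ n → Injective _≡_ _≡_ (gadgetColour ∘ gadget n)
gadget-strong = from-yes (all? λ n → injective? (gadgetColour ∘ gadget n))

gadget-colours₀ : gadgetColour ∘ gadget 0F ≗ palette₀
gadget-colours₀ = from-yes (all? λ k → gadgetColour (gadget 0F k) ≟ palette₀ k)

gadget-colours₁ : gadgetColour ∘ gadget 1F ≗ palette₁
gadget-colours₁ = from-yes (all? λ k → gadgetColour (gadget 1F k) ≟ palette₁ k)

gadget-disjoint : ∀ i j → gadget 0F i ≢ gadget 1F j
gadget-disjoint = from-yes (all? λ i → all? λ j → ¬? (gadget 0F i ≟ gadget 1F j))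

gadget-descending : Descending gadget
gadget-descending = from-yes (descending? gadget)

module Expansion {w} (E : Expandable w) where
  open Expandable E

  hub : Fin 4 → Fin (4 + (2 + w))
  hub a = a ↑ˡ (2 + w)

  old : Fin (2 + w) → Fin (4 + (2 + w))
  old = 4 ↑ʳ_

  old-injective : Injective _≡_ _≡_ old
  old-injective = ↑ʳ-injective 4 _ _

  hub≢old : ∀ a p → hub a ≢ old p
  hub≢old = ↑ˡ≢↑ʳ

  attachment : Fin 6 → Fin (2 + w)
  attachment = block config 0F ++ block config 1F

  attachment-injective : Injective _≡_ _≡_ attachment
  attachment-injective = ++-injective (block-inj config 0F _ _) (block-inj config 1F _ _) disjoint

  attachment∈removed : ∀ t → ∃ λ k → attachment t ∈ᵇ block config (k ↑ˡ w)
  attachment∈removed = ↑-cases (λ i → 0F , i , sym (lookup-++ˡ (block config 0F) _ i)) (λ i → 1F , i , refl)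

  removed⇒attachment : ∀ k {p} → p ∈ᵇ block config (k ↑ˡ w) → ∃ λ t → attachment t ≡ p
  removed⇒attachment 0F (i , bi≡p) = i ↑ˡ 3 , trans (lookup-++ˡ (block config 0F) _ i) bi≡p
  removed⇒attachment 1F (i , bi≡p) = 3 ↑ʳ i , bi≡p

  removed-unique : ∀ k k′ {p} → p ∈ᵇ block config (k ↑ˡ w) → p ∈ᵇ block config (k′ ↑ˡ w) → k ≡ k′
  removed-unique 0F 0F _ _ = refl
  removed-unique 0F 1F (i , e) (j , e′) = contradiction (trans e (sym e′)) (disjoint i j)
  removed-unique 1F 0F (i , e) (j , e′) = contradiction (trans e′ (sym e)) (disjoint j i)
  removed-unique 1F 1F _ _ = refl

  embed : Fin 10 → Fin (4 + (2 + w))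
  embed = hub ++ (old ∘ attachment)

  embed-injective : Injective _≡_ _≡_ embed
  embed-injective = ++-injective (↑ˡ-injective _ _ _) (attachment-injective ∘ old-injective) (λ a t → hub≢old a (attachment t))

  embed-hub : ∀ a → embed (a ↑ˡ 6) ≡ hub a
  embed-hub = lookup-++ˡ hub (old ∘ attachment)

  embed≡old : ∀ x {p} → embed x ≡ old p → ∃ λ t → x ≡ 4 ↑ʳ t × attachment t ≡ p
  embed≡old = ↑-cases (λ a e → contradiction (trans (sym (embed-hub a)) e) (hub≢old a _))
                      (λ t e → t , refl , old-injective e)

  gadget-oneOld : ∀ n {i j p q} → embed (gadget n i) ≡ old p → embed (gadget n j) ≡ old q → i ≡ j
  gadget-oneOld n {i} {j} e e′ with embed≡old (gadget n i) e | embed≡old (gadget n j) e′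
  ... | t , gi≡t , _ | t′ , gj≡t′ , _ = gadget-oneAttachment n i j t t′ gi≡t gj≡t′

  newBlock : Fin (6 + w) → Fin 3 → Fin (4 + (2 + w))
  newBlock = (λ n → embed ∘ gadget n) ++ (λ c → old ∘ block config (2 ↑ʳ c))

  newBlock-gadget : ∀ n → newBlock (n ↑ˡ w) ≡ embed ∘ gadget n
  newBlock-gadget = lookup-++ˡ _ _

  locate : Fin (2 + w) → Fin 6
  locate = preimage attachment

  -- For p on block b, the block replacing b through p; p lies on at most one removed block.
  relocate : Fin (2 + w) → Fin (2 + w) → Fin (6 + w)
  relocate p = (λ _ → home (locate p) ↑ˡ w) ++ (6 ↑ʳ_)

  relocate-removed : ∀ p k → relocate p (k ↑ˡ w) ≡ home (locate p) ↑ˡ w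
  relocate-removed p = lookup-++ˡ _ _

  newThrough : Fin (4 + (2 + w)) → Fin 3 → Fin (6 + w)
  newThrough = (λ a → (_↑ˡ w) ∘ hubBlocks a) ++ (λ p → relocate p ∘ through config p)

  newThrough-hub : ∀ a → newThrough (hub a) ≡ (_↑ˡ w) ∘ hubBlocks a
  newThrough-hub = lookup-++ˡ _ _

  newBlock-injective : ∀ b → Injective _≡_ _≡_ (newBlock b)
  newBlock-injective = ↑-cases
    (λ n → subst (Injective _≡_ _≡_) (sym (newBlock-gadget n)) (gadget-injective n ∘ embed-injective))
    (λ c → block-inj config (2 ↑ʳ c) _ _ ∘ old-injective)

  newBlock-meetOnce : MeetOnce newBlock
  newBlock-meetOnce = ↑-cases {P = λ b → ∀ b′ → MeetsOnce newBlock b b′}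
    (λ n → ↑-cases (new-new n) (new-old n))
    (λ c → ↑-cases (old-new c) (old-old c))
    where
    new-new : ∀ n n′ → MeetsOnce newBlock (n ↑ˡ w) (n′ ↑ˡ w)
    new-new n n′ b≢b′ i j i′ j′ rewrite newBlock-gadget n | newBlock-gadget n′ =
      λ e e′ → gadget-meetOnce n n′ (b≢b′ ∘ cong (_↑ˡ w)) i j i′ j′ (embed-injective e) (embed-injective e′)
    new-old : ∀ n c → MeetsOnce newBlock (n ↑ˡ w) (6 ↑ʳ c)
    new-old n c _ i j i′ j′ rewrite newBlock-gadget n = gadget-oneOld n
    old-new : ∀ c n → MeetsOnce newBlock (6 ↑ʳ c) (n ↑ˡ w)
    old-new c n _ i j i′ j′ rewrite newBlock-gadget n = λ e e′ →
      block-inj config (2 ↑ʳ c) i j (old-injective (begin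
        old (block config (2 ↑ʳ c) i)  ≡⟨ e ⟩
        embed (gadget n i′)            ≡⟨ cong (embed ∘ gadget n) (gadget-oneOld n (sym e) (sym e′)) ⟩
        embed (gadget n j′)            ≡⟨ e′ ⟨
        old (block config (2 ↑ʳ c) j)  ∎))
      where open ≡-Reasoning
    old-old : ∀ c c′ → MeetsOnce newBlock (6 ↑ʳ c) (6 ↑ʳ c′)
    old-old c c′ b≢b′ i j i′ j′ e e′ =
      linear⇒meetOnce config (2 ↑ʳ c) (2 ↑ʳ c′) (b≢b′ ∘ cong old) i j i′ j′
                      (old-injective e) (old-injective e′)

  relocate-injective : ∀ p b b′ → p ∈ᵇ block config b → p ∈ᵇ block config b′ →
                       relocate p b ≡ relocate p b′ → b ≡ b′
  relocate-injective p = ↑-cases {P = λ b → ∀ b′ → p ∈ᵇ block config b → p ∈ᵇ block config b′ → relocate p b ≡ relocate p b′ → b ≡ b′}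
    (λ k → ↑-cases (λ k′ p∈k p∈k′ _ → cong (_↑ˡ w) (removed-unique k k′ p∈k p∈k′))
                   (λ c _ _ e → contradiction (trans (sym (relocate-removed p k)) e) (↑ˡ≢↑ʳ _ c)))
    (λ c → ↑-cases (λ k _ _ e → contradiction (trans (sym (relocate-removed p k)) (sym e)) (↑ˡ≢↑ʳ _ c))
                   (λ c′ _ _ e → cong (2 ↑ʳ_) (↑ʳ-injective 6 _ _ e)))

  newThrough-injective : ∀ x → Injective _≡_ _≡_ (newThrough x)
  newThrough-injective = ↑-cases
    (λ a → subst (Injective _≡_ _≡_) (sym (newThrough-hub a)) (hubBlocks-injective a ∘ ↑ˡ-injective w _ _))
    (λ p {i} {j} e → through-inj config p i j
       (relocate-injective p _ _ (through-inc config p i) (through-inc config p j) e))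

  old∈relocated : ∀ p b → p ∈ᵇ block config b → old p ∈ᵇ newBlock (relocate p b)
  old∈relocated p = ↑-cases {P = λ b → p ∈ᵇ block config b → old p ∈ᵇ newBlock (relocate p b)}
    removed (λ c (i , e) → i , cong old e)
    where
    removed : ∀ k → p ∈ᵇ block config (k ↑ˡ w) → old p ∈ᵇ newBlock (relocate p (k ↑ˡ w))
    removed k p∈k with removed⇒attachment k p∈k
    ... | t , refl with attachment∈home t
    ...   | i , e rewrite relocate-removed (attachment t) k | newBlock-gadget (home (locate (attachment t)))
                        | preimage-correct attachment-injective {t} refl = i , cong embed e

  newThrough-incident : ∀ x i → x ∈ᵇ newBlock (newThrough x i)
  newThrough-incident = ↑-cases hub∈ (λ p i → old∈relocated p (through config p i) (through-inc config p i))
    where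
    hub∈ : ∀ a i → hub a ∈ᵇ newBlock (newThrough (hub a) i)
    hub∈ a i with hub∈hubBlocks a i
    ... | k , e rewrite newThrough-hub a | newBlock-gadget (hubBlocks a i) = k , trans (cong embed e) (embed-hub a)

  newThrough-complete : ∀ x b → x ∈ᵇ newBlock b → ∃ λ i → newThrough x i ≡ b
  newThrough-complete = ↑-cases
    (λ a → ↑-cases (hub-new a) (λ c (k , e) → contradiction (sym e) (hub≢old a _)))
    (λ p → ↑-cases (old-new p) (old-old p))
    where
    open ≡-Reasoning
    hub-new : ∀ a n → hub a ∈ᵇ newBlock (n ↑ˡ w) → ∃ λ i → newThrough (hub a) i ≡ n ↑ˡ w
    hub-new a n hub∈n with subst (hub a ∈ᵇ_) (newBlock-gadget n) hub∈n
    ... | k , e with hubBlocks-complete a n (k , embed-injective (trans e (sym (embed-hub a))))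
    ...   | i , e′ = i , trans (cong-app (newThrough-hub a) i) (cong (_↑ˡ w) e′)
    old-new : ∀ p n → old p ∈ᵇ newBlock (n ↑ˡ w) → ∃ λ i → newThrough (old p) i ≡ n ↑ˡ w
    old-new p n old∈n with subst (old p ∈ᵇ_) (newBlock-gadget n) old∈n
    ... | k , e with embed≡old (gadget n k) e
    ...   | t , gk≡t , refl with attachment∈removed t
    ...     | r , t∈r with through-all config (attachment t) (r ↑ˡ w) t∈r
    ...       | i , through≡r = i , (begin
      relocate (attachment t) (through config (attachment t) i)  ≡⟨ cong (relocate _) through≡r ⟩
      relocate (attachment t) (r ↑ˡ w)                           ≡⟨ relocate-removed _ r ⟩
      home (locate (attachment t)) ↑ˡ w                          ≡⟨ cong (λ s → home s ↑ˡ w)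
                                                                     (preimage-correct attachment-injective {t} refl) ⟩
      home t ↑ˡ w                                                ≡⟨ cong (_↑ˡ w) (home-unique n k t gk≡t) ⟩
      n ↑ˡ w                                                     ∎)
    old-old : ∀ p c → old p ∈ᵇ newBlock (6 ↑ʳ c) → ∃ λ i → newThrough (old p) i ≡ 6 ↑ʳ c
    old-old p c (k , e) with through-all config p (2 ↑ʳ c) (k , old-injective e)
    ... | i , e′ = i , cong (relocate p) e′

  newConfiguration : Configuration (4 + (2 + w))
  newConfiguration = record
    { block       = newBlock
    ; block-inj   = λ b _ _ → newBlock-injective b
    ; through     = newThrough
    ; through-inj = λ x _ _ → newThrough-injective x
    ; through-inc = newThrough-incident
    ; through-all = newThrough-complete
    ; linear      = meetOnce⇒linear newBlock-meetOnce
    }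

  newColour : Fin (4 + (2 + w)) → Fin 5
  newColour = inject₁ ++ colour

  newColour-embed : newColour ∘ embed ≗ gadgetColour
  newColour-embed = ↑-cases hub-colour (↑-cases {P = λ t → colour (attachment t) ≡ (palette₀ ++ palette₁) t}
    (λ i → trans (cong colour (lookup-++ˡ _ _ i)) (trans (colours₀ i) (sym (lookup-++ˡ palette₀ palette₁ i))))
    colours₁)
    where
    open ≡-Reasoning
    hub-colour : ∀ a → newColour (embed (a ↑ˡ 6)) ≡ gadgetColour (a ↑ˡ 6)
    hub-colour a = begin
      newColour (embed (a ↑ˡ 6))  ≡⟨ cong newColour (embed-hub a) ⟩
      newColour (hub a)           ≡⟨ lookup-++ˡ inject₁ colour a ⟩
      inject₁ a                   ≡⟨ lookup-++ˡ inject₁ _ a ⟨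
      gadgetColour (a ↑ˡ 6)       ∎

  newColour-strong : ∀ b i j → newColour (newBlock b i) ≡ newColour (newBlock b j) → i ≡ j
  newColour-strong = ↑-cases new (λ c → strong (2 ↑ʳ c))
    where
    new : ∀ n i j → newColour (newBlock (n ↑ˡ w) i) ≡ newColour (newBlock (n ↑ˡ w) j) → i ≡ j
    new n i j rewrite newBlock-gadget n = λ e →
      gadget-strong n (trans (sym (newColour-embed (gadget n i))) (trans e (newColour-embed (gadget n j))))

  newConnected : Connected newConfiguration
  newConnected S constant x y = trans (to-base x) (sym (to-base y))
    where
    gadget-constant : ConstantOnBlocks gadget (S ∘ embed)
    gadget-constant n i j = subst (λ B → S (B i) ≡ S (B j)) (newBlock-gadget n) (constant (n ↑ˡ w) i j)
    embed-constant : ∀ z → S (embed z) ≡ S (embed 0F)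
    embed-constant = descending⇒constant gadget-descending gadget-constant
    removed-constant : ∀ k i → S (old (block config (k ↑ˡ w) i)) ≡ S (embed 0F)
    removed-constant k i with removed⇒attachment k (i , refl)
    ... | t , e = trans (cong (S ∘ old) (sym e)) (embed-constant (4 ↑ʳ t))
    old-constant : ConstantOnBlocks (block config) (S ∘ old)
    old-constant = ↑-cases {P = λ b → ∀ i j → S (old (block config b i)) ≡ S (old (block config b j))}
      (λ k i j → trans (removed-constant k i) (sym (removed-constant k j)))
      (λ c → constant (6 ↑ʳ c))
    to-base : ∀ z → S z ≡ S (embed 0F)
    to-base = ↑-cases (λ a → trans (cong S (sym (embed-hub a))) (embed-constant (a ↑ˡ 6)))
                      (λ p → trans (connected (S ∘ old) old-constant p (attachment 0F)) (embed-constant (4 ↑ʳ 0F)))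

  newClique-collinear : ∀ i j → i ≢ j →
    ∃ λ c → old (clique i) ∈ᵇ newBlock (6 ↑ʳ c) × old (clique j) ∈ᵇ newBlock (6 ↑ʳ c)
  newClique-collinear i j i≢j with clique-collinear i j i≢j
  ... | c , (k , e) , (l , e′) = c , (k , cong old e) , (l , cong old e′)

  expanded : Expandable (4 + w)
  expanded = record
    { config           = newConfiguration
    ; connected        = newConnected
    ; colour           = newColour
    ; strong           = newColour-strong
    ; colours₀         = λ k → trans (newColour-embed (gadget 0F k)) (gadget-colours₀ k)
    ; colours₁         = λ k → trans (newColour-embed (gadget 1F k)) (gadget-colours₁ k)
    ; disjoint         = λ i j → gadget-disjoint i j ∘ embed-injective
    ; clique           = old ∘ clique
    ; clique-injective = clique-injective ∘ old-injective
    ; clique-collinear = λ i j i≢j → let c , on-i , on-j = newClique-collinear i j i≢j in 4 ↑ʳ c , on-i , on-j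
    }

expandable : ∀ n → Expandable (10 + n * 4)
expandable zero    = Base.expandable
expandable (suc n) = Expansion.expanded (expandable n)

theorem25 : (v : ℕ) → 4 ∣ v → 12 ≤ v →
    Σ (Configuration v) λ C → Connected C × StrongChromaticNumber C 5
theorem25 _ (divides (suc (suc (suc n))) refl) _ =
  Expandable.config (expandable n) , expandable⇒strongChromaticNumber (expandable n)
theorem25 _ (divides 0 refl) 12≤0 = contradiction 12≤0 (from-no (12 ≤? 0))
theorem25 _ (divides 1 refl) 12≤4 = contradiction 12≤4 (from-no (12 ≤? 4))
theorem25 _ (divides 2 refl) 12≤8 = contradiction 12≤8 (from-no (12 ≤? 8))
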